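{- Let $H$ be a finite graph and $a,b$ two vertices of $H$ with $ab\notin E(H)$. Write $f=f_{a,b,H}$ and $g=g_{a,b,H}$ (polynomials in $p$). Then for every $j=0,1,\dots,e(H)$ we have $[j]f\cdot[j]g\ge 0$. Moreover, $[0]f=[0]g$, $[1]f=[1]g$ and $|[2]f|\ge|[2]g|$.
   Context: For $p\in[0,1]$ define the kernel $U_p:[0,1]^2\to\mathbb{R}$ by $U_p(x,y)=2p-1$ if $(x,y)\in[0,1/2)^2$ or $(x,y)\in[1/2,1]^2$, and $U_p(x,y)=-1$ otherwise. Let $I_1=[0,1/2)$, $I_2=[1/2,1]$. For a graph $H$ and vertices $a,b$, define $f_{a,b,H}(p)=\int_{I_1\times I_1}\left(\int_{[0,1]^{v(H)-2}}\prod_{uv\in E(H)}U_p(x_u,x_v)\prod_{k\in V(H)\setminus\{a,b\}}dx_k\right)dx_a\,dx_b$ and $g_{a,b,H}(p)$ the same integral with the outer domain $I_1\times I_2$ instead of $I_1\times I_1$. These are polynomials in $p$. For a polynomial $f(p)$, $[j]f$ denotes the coefficient of $p^j$. -}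

module Defs where

open import Data.Bool using (Bool; true; false; if_then_else_)
open import Data.Bool.Properties using () renaming (_≟_ to _≟ᵇ_)
open import Data.Nat as ℕ using (ℕ; zero; suc)
open import Data.Fin using (Fin; toℕ)
import Data.Fin as Fin
open import Data.List using (List; []; _∷_; map; foldr; concatMap; filter; length; _++_; allFin)
open import Data.Product using (_×_; _,_; proj₁; proj₂)
open import Data.Rational using (ℚ; 0ℚ; 1ℚ; ½; _+_; _*_; -_)
open import Relation.Binary.PropositionalEquality using (_≡_)
open import Relation.Nullary using (¬_; Dec; yes; no)
open import Relation.Nullary.Decidable using (does)

record Graph (n : ℕ) : Set where
  field
    adj     : Fin n → Fin n → Bool
    symm    : ∀ u v → adj u v ≡ adj v u
    irrefl  : ∀ u → adj u u ≡ false
open Graph public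

-- Polynomials in p with rational coefficients, as ascending coefficient lists.
Poly : Set
Poly = List ℚ

addP : Poly → Poly → Poly
addP [] q = q
addP (x ∷ p) [] = x ∷ p
addP (x ∷ p) (y ∷ q) = (x + y) ∷ addP p q

scaleP : ℚ → Poly → Poly
scaleP c = map (c *_)

mulP : Poly → Poly → Poly
mulP [] q = []
mulP (x ∷ p) q = addP (scaleP x q) (0ℚ ∷ mulP p q)

constP : ℚ → Poly
constP c = c ∷ []

coeff : Poly → ℕ → ℚ
coeff [] j = 0ℚ
coeff (x ∷ p) zero = x
coeff (x ∷ p) (suc j) = coeff p j

-- The value of U_p on a cell: part labels false = I₁ = [0,1/2), true = I₂ = [1/2,1].
-- Same part: 2p - 1 ; different parts: -1.
Ucell : Bool → Bool → Poly
Ucell s t = if does (s ≟ᵇ t) then (- 1ℚ) ∷ (1ℚ + 1ℚ) ∷ [] else constP (- 1ℚ)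

edges : ∀ {n} → Graph n → List (Fin n × Fin n)
edges {n} H = concatMap (λ u → concatMap (λ v →
    if does (toℕ u ℕ.<? toℕ v) then (if adj H u v then (u , v) ∷ [] else []) else [])
    (allFin n)) (allFin n)

e : ∀ {n} → Graph n → ℕ
e H = length (edges H)

consB : ∀ {n} → Bool → (Fin n → Bool) → Fin (suc n) → Bool
consB x σ Fin.zero = x
consB x σ (Fin.suc i) = σ i

assignments : (n : ℕ) → List (Fin n → Bool)
assignments zero = (λ ()) ∷ []
assignments (suc n) = concatMap (λ σ → (consB false σ) ∷ (consB true σ) ∷ []) (assignments n)

prodP : List Poly → Poly
prodP = foldr mulP (constP 1ℚ)

sumP : List Poly → Poly
sumP = foldr addP []

halfPow : ℕ → ℚ
halfPow zero = 1ℚ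
halfPow (suc n) = ½ * halfPow n

edgeProd : ∀ {n} → Graph n → (Fin n → Bool) → Poly
edgeProd H σ = prodP (map (λ uv → Ucell (σ (proj₁ uv)) (σ (proj₂ uv))) (edges H))

-- The integrand of ∏ U_p is constant on each cell ∏_k I_{σ(k)} (of measure (1/2)^n),
-- so the integral over the region where x_a ∈ I₁ and x_b ∈ I_{sb} is the finite sum
-- (1/2)^n · Σ_{σ : σ a = I₁, σ b = I_{sb}} ∏_{uv ∈ E} U(σ u, σ v).
cellIntegral : ∀ {n} → Graph n → Fin n → Fin n → Bool → Poly
cellIntegral {n} H a b sb =
  scaleP (halfPow n)
    (sumP (map (edgeProd H)
      (filter (λ σ → σ a ≟ᵇ false) (filter (λ σ → σ b ≟ᵇ sb) (assignments n)))))

f : ∀ {n} → Graph n → Fin n → Fin n → Poly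
f H a b = cellIntegral H a b false

g : ∀ {n} → Graph n → Fin n → Fin n → Poly
g H a b = cellIntegral H a b true

{-# OPTIONS --safe #-}
module Submission where

-- On the cell of an assignment σ of the vertices to I₁, I₂ the integrand is
-- (2p − 1)^m (−1)^(e − m), with m the number of σ-monochromatic edges, so the
-- p^j-coefficient is 2^(−n) (−1)^(e+j) 2^j Σ_σ C(m(σ), j).  Counting j-sets S of
-- monochromatic edges instead, Σ_σ C(m(σ), j) = Σ_{|S| = j} N(S), where N(S) counts the
-- assignments of the relevant region (σ a ∈ I₁, and σ b ∈ I₁ for f, σ b ∈ I₂ for g) under
-- which every edge of S is monochromatic.  Hence [j]f and [j]g have the same sign, and
-- |[j]g| ≤ |[j]f| follows from N_g(S) ≤ N_f(S): recolouring the component of b in the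
-- graph S maps the region of g bijectively onto that of f and preserves monochromatic
-- edges, unless a lies in that component, in which case N_g(S) = 0.  When |S| ≤ 1 and
-- ab ∉ E(H) it never does, which gives [0]f = [0]g and [1]f = [1]g.

open import Defs

open import Function using (_∘_; Equivalence)
open import Data.Bool using (Bool; true; false; if_then_else_; not; _∨_; _∧_; _xor_; T)
open import Data.Bool.Properties using (T-≡; ∨-zeroʳ) renaming (_≟_ to _≟ᵇ_)
open import Data.Bool.ListAction using (and; all)
open import Data.Nat as ℕ using (ℕ; zero; suc; _+_; _≤_; z≤n; s≤s)
open import Data.Nat.Properties using (+-comm; +-identityʳ; +-mono-≤; ≤-reflexive; +-commutativeSemigroup)
open import Algebra.Properties.CommutativeSemigroup +-commutativeSemigroup using () renaming (interchange to +-interchange)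
open import Data.Nat.ListAction using (sum)
open import Data.Nat.ListAction.Properties using (sum-++)
open import Data.Nat.Combinatorics using (_C_; nCk+nC[k+1]≡[n+1]C[k+1])
open import Data.Fin as Fin using (Fin)
open import Data.List using (List; []; _∷_; _++_; map; filter; concatMap; length; allFin)
open import Data.List.Properties using (map-cong; map-++; map-∘)
open import Data.List.Relation.Unary.All as All using (All; []; _∷_)
open import Data.List.Relation.Unary.All.Properties using (all⁺; all⁻; concat⁺; map⁺)
open import Data.List.Membership.Propositional using (_∈_)
open import Data.Product using (_×_; _,_; proj₁; proj₂)
open import Data.Sum using (_⊎_; inj₁; inj₂)
open import Data.Rational using (ℚ; 0ℚ; 1ℚ; -_; _*_; ∣_∣; nonNegative) renaming (_+_ to _+ℚ_; _≤_ to _≤ℚ_)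
import Data.Rational.Properties as ℚ
open import Data.Rational.Solver using (module +-*-Solver)
open import Relation.Nullary using (does; yes; no; _⊎-dec_)
open import Relation.Nullary.Decidable using (dec-true; dec-false)
open import Relation.Unary using (Pred; Decidable)
open import Relation.Binary.PropositionalEquality

private variable
  A B : Set
  n : ℕ

𝟙 : Bool → ℕ
𝟙 β = if β then 1 else 0

∑ : List A → (A → ℕ) → ℕ
∑ xs f = sum (map f xs)

count : (A → Bool) → List A → ℕ
count p xs = ∑ xs (𝟙 ∘ p)

∑-cong : ∀ (xs : List A) {f g : A → ℕ} → (∀ x → f x ≡ g x) → ∑ xs f ≡ ∑ xs g
∑-cong xs f≗g = cong sum (map-cong f≗g xs)

∑-++ : ∀ (xs ys : List A) f → ∑ (xs ++ ys) f ≡ ∑ xs f + ∑ ys f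
∑-++ xs ys f = trans (cong sum (map-++ f xs ys)) (sum-++ (map f xs) (map f ys))

∑-map : ∀ (g : A → B) xs f → ∑ (map g xs) f ≡ ∑ xs (f ∘ g)
∑-map g xs f = cong sum (sym (map-∘ xs))

∑-concatMap : ∀ (g : A → List B) xs f → ∑ (concatMap g xs) f ≡ ∑ xs (λ x → ∑ (g x) f)
∑-concatMap g []       f = refl
∑-concatMap g (x ∷ xs) f = trans (∑-++ (g x) (concatMap g xs) f) (cong (∑ (g x) f +_) (∑-concatMap g xs f))

∑-filter : ∀ {ℓ} {P : Pred A ℓ} (P? : Decidable P) xs f →
           ∑ (filter P? xs) f ≡ ∑ xs (λ x → if does (P? x) then f x else 0)
∑-filter P? []       f = refl
∑-filter P? (x ∷ xs) f with does (P? x)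
... | true  = cong (f x +_) (∑-filter P? xs f)
... | false = ∑-filter P? xs f

∑-+ : ∀ (xs : List A) f g → ∑ xs (λ x → f x + g x) ≡ ∑ xs f + ∑ xs g
∑-+ []       f g = refl
∑-+ (x ∷ xs) f g =
  trans (cong ((f x + g x) +_) (∑-+ xs f g)) (+-interchange (f x) (g x) (∑ xs f) (∑ xs g))

∑-zero : ∀ (xs : List A) {f} → All (λ x → f x ≡ 0) xs → ∑ xs f ≡ 0
∑-zero []       []           = refl
∑-zero (x ∷ xs) (fx≡0 ∷ all0) = cong₂ _+_ fx≡0 (∑-zero xs all0)

∑-swap : ∀ (xs : List A) (ys : List B) (f : A → B → ℕ) →
         ∑ xs (λ x → ∑ ys (f x)) ≡ ∑ ys (λ y → ∑ xs (λ x → f x y))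
∑-swap []       ys f = sym (∑-zero ys {λ _ → 0} (All.universal (λ _ → refl) ys))
∑-swap (x ∷ xs) ys f =
  trans (cong (∑ ys (f x) +_) (∑-swap xs ys f)) (sym (∑-+ ys (f x) (λ y → ∑ xs (λ x → f x y))))

∑-mono : ∀ (xs : List A) {f g} → (∀ x → f x ≤ g x) → ∑ xs f ≤ ∑ xs g
∑-mono []       f≤g = z≤n
∑-mono (x ∷ xs) f≤g = +-mono-≤ (f≤g x) (∑-mono xs f≤g)

choose : ℕ → List A → List (List A)
choose zero    xs       = [] ∷ []
choose (suc k) []       = []
choose (suc k) (x ∷ xs) = map (x ∷_) (choose k xs) ++ choose (suc k) xs

count-∧ : ∀ β (q : A → Bool) xs → count (λ x → β ∧ q x) xs ≡ (if β then count q xs else 0)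
count-∧ true  q xs = refl
count-∧ false q xs = ∑-zero xs (All.universal (λ _ → refl) xs)

[𝟙+m]C[1+k] : ∀ β m k → (𝟙 β + m) C suc k ≡ (if β then m C k else 0) + m C suc k
[𝟙+m]C[1+k] true  m k = sym (nCk+nC[k+1]≡[n+1]C[k+1] m k)
[𝟙+m]C[1+k] false m k = refl

count-C : ∀ (p : A → Bool) k xs → count p xs C k ≡ count (all p) (choose k xs)
count-C p zero    xs       = refl
count-C p (suc k) []       = refl
count-C p (suc k) (x ∷ xs) = begin
  (𝟙 (p x) + count p xs) C suc k
    ≡⟨ [𝟙+m]C[1+k] (p x) (count p xs) k ⟩
  (if p x then count p xs C k else 0) + count p xs C suc k
    ≡⟨ cong₂ (λ c d → (if p x then c else 0) + d) (count-C p k xs) (count-C p (suc k) xs) ⟩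
  (if p x then count (all p) (choose k xs) else 0) + count (all p) (choose (suc k) xs)
    ≡⟨ cong (_+ count (all p) (choose (suc k) xs)) (sym (count-∧ (p x) (all p) (choose k xs))) ⟩
  count (λ S → p x ∧ all p S) (choose k xs) + count (all p) (choose (suc k) xs)
    ≡⟨ cong (_+ count (all p) (choose (suc k) xs)) (sym (∑-map (x ∷_) (choose k xs) (𝟙 ∘ all p))) ⟩
  count (all p) (map (x ∷_) (choose k xs)) + count (all p) (choose (suc k) xs)
    ≡⟨ sym (∑-++ (map (x ∷_) (choose k xs)) (choose (suc k) xs) (𝟙 ∘ all p)) ⟩
  count (all p) (choose (suc k) (x ∷ xs)) ∎
  where open ≡-Reasoning

fromℕ : ℕ → ℚ
fromℕ zero    = 0ℚ
fromℕ (suc m) = 1ℚ +ℚ fromℕ m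

fromℕ-+ : ∀ m k → fromℕ (m + k) ≡ fromℕ m +ℚ fromℕ k
fromℕ-+ zero    k = sym (ℚ.+-identityˡ (fromℕ k))
fromℕ-+ (suc m) k = trans (cong (1ℚ +ℚ_) (fromℕ-+ m k)) (sym (ℚ.+-assoc 1ℚ (fromℕ m) (fromℕ k)))

0≤fromℕ : ∀ m → 0ℚ ≤ℚ fromℕ m
0≤fromℕ zero    = ℚ.≤-refl
0≤fromℕ (suc m) = ℚ.+-mono-≤ (ℚ.nonNegative⁻¹ 1ℚ) (0≤fromℕ m)

fromℕ-mono-≤ : ∀ {m k} → m ≤ k → fromℕ m ≤ℚ fromℕ k
fromℕ-mono-≤ {k = k} z≤n = 0≤fromℕ k
fromℕ-mono-≤ (s≤s m≤k)   = ℚ.+-monoʳ-≤ 1ℚ (fromℕ-mono-≤ m≤k)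

0≤p*q : ∀ {p q} → 0ℚ ≤ℚ p → 0ℚ ≤ℚ q → 0ℚ ≤ℚ p * q
0≤p*q {p} {q} 0≤p 0≤q =
  ℚ.nonNegative⁻¹ (p * q) {{ℚ.nonNeg*nonNeg⇒nonNeg p {{nonNegative 0≤p}} q {{nonNegative 0≤q}}}}

0≤p*p : ∀ p → 0ℚ ≤ℚ p * p
0≤p*p p with ℚ.∣p∣≡p∨∣p∣≡-p p
... | inj₁ ∣p∣≡p  = subst (λ x → 0ℚ ≤ℚ x * x) ∣p∣≡p (0≤p*q (ℚ.0≤∣p∣ p) (ℚ.0≤∣p∣ p))
... | inj₂ ∣p∣≡-p = subst (0ℚ ≤ℚ_) (trans (cong₂ _*_ ∣p∣≡-p ∣p∣≡-p) (-p*-q≡p*q p p))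
                          (0≤p*q (ℚ.0≤∣p∣ p) (ℚ.0≤∣p∣ p))
  where
  -p*-q≡p*q : ∀ p q → (- p) * (- q) ≡ p * q
  -p*-q≡p*q = +-*-Solver.solve 2 (λ p q → (:- p) :* (:- q) := p :* q) refl
    where open +-*-Solver

∣p*fromℕ∣ : ∀ p m → ∣ p * fromℕ m ∣ ≡ ∣ p ∣ * fromℕ m
∣p*fromℕ∣ p m = trans (ℚ.∣p*q∣≡∣p∣*∣q∣ p (fromℕ m)) (cong (∣ p ∣ *_) (ℚ.0≤p⇒∣p∣≡p (0≤fromℕ m)))

coeff-addP : ∀ p q j → coeff (addP p q) j ≡ coeff p j +ℚ coeff q j
coeff-addP []      q       j       = sym (ℚ.+-identityˡ (coeff q j))
coeff-addP (x ∷ p) []      j       = sym (ℚ.+-identityʳ (coeff (x ∷ p) j))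
coeff-addP (x ∷ p) (y ∷ q) zero    = refl
coeff-addP (x ∷ p) (y ∷ q) (suc j) = coeff-addP p q j

coeff-scaleP : ∀ c p j → coeff (scaleP c p) j ≡ c * coeff p j
coeff-scaleP c []      j       = sym (ℚ.*-zeroʳ c)
coeff-scaleP c (x ∷ p) zero    = refl
coeff-scaleP c (x ∷ p) (suc j) = coeff-scaleP c p j

coeff-mulP-∷ : ∀ c p q j → coeff (mulP (c ∷ p) q) j ≡ c * coeff q j +ℚ coeff (0ℚ ∷ mulP p q) j
coeff-mulP-∷ c p q j =
  trans (coeff-addP (scaleP c q) (0ℚ ∷ mulP p q) j) (cong (_+ℚ coeff (0ℚ ∷ mulP p q) j) (coeff-scaleP c q j))

coeff-mulP-constP : ∀ c q j → coeff (mulP (constP c) q) j ≡ c * coeff q j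
coeff-mulP-constP c q zero    = trans (coeff-mulP-∷ c [] q zero) (ℚ.+-identityʳ _)
coeff-mulP-constP c q (suc j) = trans (coeff-mulP-∷ c [] q (suc j)) (ℚ.+-identityʳ _)

2ℚ : ℚ
2ℚ = 1ℚ +ℚ 1ℚ

-- κ L j = (−1)^(L+j) 2^j: a product of L factors U, m of them equal to 2p − 1 and the
-- others to −1, has p^j-coefficient κ L j · C(m, j).
κ : ℕ → ℕ → ℚ
κ zero    zero    = 1ℚ
κ zero    (suc j) = - (2ℚ * κ zero j)
κ (suc L) j       = - κ L j

κ-suc : ∀ L j → κ L (suc j) ≡ - (2ℚ * κ L j)
κ-suc zero    j = refl
κ-suc (suc L) j = cong -_ (trans (κ-suc L j) (ℚ.neg-distribʳ-* 2ℚ (κ L j)))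

coeff-mulP-[-1] : ∀ q L m → (∀ j → coeff q j ≡ κ L j * fromℕ (m C j)) → ∀ j →
                  coeff (mulP (constP (- 1ℚ)) q) j ≡ κ (suc L) j * fromℕ (m C j)
coeff-mulP-[-1] q L m coeff-q j = begin
  coeff (mulP (constP (- 1ℚ)) q) j  ≡⟨ coeff-mulP-constP (- 1ℚ) q j ⟩
  - 1ℚ * coeff q j                  ≡⟨ cong (- 1ℚ *_) (coeff-q j) ⟩
  - 1ℚ * (κ L j * fromℕ (m C j))    ≡⟨ solve 2 (λ k c → con (- 1ℚ) :* (k :* c) := (:- k) :* c) refl
                                                (κ L j) (fromℕ (m C j)) ⟩
  - κ L j * fromℕ (m C j)           ∎
  where open ≡-Reasoning; open +-*-Solver

coeff-mulP-[2p-1] : ∀ q L m → (∀ j → coeff q j ≡ κ L j * fromℕ (m C j)) → ∀ j →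
                    coeff (mulP ((- 1ℚ) ∷ 2ℚ ∷ []) q) j ≡ κ (suc L) j * fromℕ (suc m C j)
coeff-mulP-[2p-1] q L m coeff-q zero = begin
  coeff (mulP ((- 1ℚ) ∷ 2ℚ ∷ []) q) zero ≡⟨ coeff-mulP-∷ (- 1ℚ) (2ℚ ∷ []) q zero ⟩
  - 1ℚ * coeff q zero +ℚ 0ℚ             ≡⟨ cong (λ x → - 1ℚ * x +ℚ 0ℚ) (coeff-q zero) ⟩
  - 1ℚ * (κ L zero * fromℕ 1) +ℚ 0ℚ     ≡⟨ solve 2 (λ k c → con (- 1ℚ) :* (k :* c) :+ con 0ℚ := (:- k) :* c) refl
                                                    (κ L zero) (fromℕ 1) ⟩
  - κ L zero * fromℕ 1                  ∎
  where open ≡-Reasoning; open +-*-Solver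
coeff-mulP-[2p-1] q L m coeff-q (suc j) = begin
  coeff (mulP ((- 1ℚ) ∷ 2ℚ ∷ []) q) (suc j)
    ≡⟨ coeff-mulP-∷ (- 1ℚ) (2ℚ ∷ []) q (suc j) ⟩
  - 1ℚ * coeff q (suc j) +ℚ coeff (mulP (constP 2ℚ) q) j
    ≡⟨ cong₂ (λ x y → - 1ℚ * x +ℚ y) (coeff-q (suc j))
             (trans (coeff-mulP-constP 2ℚ q j) (cong (2ℚ *_) (coeff-q j))) ⟩
  - 1ℚ * (κ L (suc j) * B₁) +ℚ 2ℚ * (κ L j * B₀)
    ≡⟨ cong (λ k → - 1ℚ * (k * B₁) +ℚ 2ℚ * (κ L j * B₀)) (κ-suc L j) ⟩
  - 1ℚ * (- (2ℚ * κ L j) * B₁) +ℚ 2ℚ * (κ L j * B₀)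
    ≡⟨ solve 3 (λ k b₀ b₁ → con (- 1ℚ) :* ((:- (con 2ℚ :* k)) :* b₁) :+ con 2ℚ :* (k :* b₀)
                           := (:- (:- (con 2ℚ :* k))) :* (b₀ :+ b₁)) refl (κ L j) B₀ B₁ ⟩
  - (- (2ℚ * κ L j)) * (B₀ +ℚ B₁)
    ≡⟨ cong₂ (λ k b → - k * b) (sym (κ-suc L j)) (sym (fromℕ-+ (m C j) (m C suc j))) ⟩
  - κ L (suc j) * fromℕ (m C j + m C suc j)
    ≡⟨ cong (λ c → - κ L (suc j) * fromℕ c) (nCk+nC[k+1]≡[n+1]C[k+1] m j) ⟩
  - κ L (suc j) * fromℕ (suc m C suc j) ∎
  where open ≡-Reasoning; open +-*-Solver
        B₀ = fromℕ (m C j)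
        B₁ = fromℕ (m C suc j)

mono : (Fin n → Bool) → Fin n × Fin n → Bool
mono σ uv = does (σ (proj₁ uv) ≟ᵇ σ (proj₂ uv))

edgeProduct : (Fin n → Bool) → List (Fin n × Fin n) → Poly
edgeProduct σ E = prodP (map (λ uv → Ucell (σ (proj₁ uv)) (σ (proj₂ uv))) E)

coeff-edgeProduct : ∀ (σ : Fin n → Bool) E j → coeff (edgeProduct σ E) j ≡ κ (length E) j * fromℕ (count (mono σ) E C j)
coeff-edgeProduct σ []       zero    = refl
coeff-edgeProduct σ []       (suc j) = sym (ℚ.*-zeroʳ (κ zero (suc j)))
coeff-edgeProduct σ (uv ∷ E) j with σ (proj₁ uv) | σ (proj₂ uv)
... | false | false = coeff-mulP-[2p-1] (edgeProduct σ E) (length E) (count (mono σ) E) (coeff-edgeProduct σ E) j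
... | true  | true  = coeff-mulP-[2p-1] (edgeProduct σ E) (length E) (count (mono σ) E) (coeff-edgeProduct σ E) j
... | false | true  = coeff-mulP-[-1]   (edgeProduct σ E) (length E) (count (mono σ) E) (coeff-edgeProduct σ E) j
... | true  | false = coeff-mulP-[-1]   (edgeProduct σ E) (length E) (count (mono σ) E) (coeff-edgeProduct σ E) j

coeff-sumP-edgeProd : ∀ (H : Graph n) L j →
  coeff (sumP (map (edgeProd H) L)) j ≡ κ (e H) j * fromℕ (∑ L (λ σ → count (mono σ) (edges H) C j))
coeff-sumP-edgeProd H []      j = sym (ℚ.*-zeroʳ (κ (e H) j))
coeff-sumP-edgeProd H (σ ∷ L) j = begin
  coeff (addP (edgeProd H σ) (sumP (map (edgeProd H) L))) j
    ≡⟨ coeff-addP (edgeProd H σ) _ j ⟩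
  coeff (edgeProd H σ) j +ℚ coeff (sumP (map (edgeProd H) L)) j
    ≡⟨ cong₂ _+ℚ_ (coeff-edgeProduct σ (edges H) j) (coeff-sumP-edgeProd H L j) ⟩
  κ (e H) j * fromℕ (N σ) +ℚ κ (e H) j * fromℕ (∑ L N)
    ≡⟨ sym (ℚ.*-distribˡ-+ (κ (e H) j) _ _) ⟩
  κ (e H) j * (fromℕ (N σ) +ℚ fromℕ (∑ L N))
    ≡⟨ cong (κ (e H) j *_) (sym (fromℕ-+ (N σ) (∑ L N))) ⟩
  κ (e H) j * fromℕ (N σ + ∑ L N) ∎
  where open ≡-Reasoning
        N : (Fin _ → Bool) → ℕ
        N σ = count (mono σ) (edges H) C j

_⊕_ : (Fin n → Bool) → (Fin n → Bool) → Fin n → Bool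
(σ ⊕ M) i = σ i xor M i

-- Assignments are functions, so reindexing a sum over them needs summands respecting _≗_.
Extensional : ((Fin n → Bool) → ℕ) → Set
Extensional h = ∀ {σ τ} → σ ≗ τ → h σ ≡ h τ

consB-cong : ∀ x {σ τ : Fin n → Bool} → σ ≗ τ → consB x σ ≗ consB x τ
consB-cong x σ≗τ Fin.zero    = refl
consB-cong x σ≗τ (Fin.suc i) = σ≗τ i

consB-⊕ : ∀ x (σ : Fin n → Bool) M → consB x σ ⊕ M ≗ consB (x xor M Fin.zero) (σ ⊕ (M ∘ Fin.suc))
consB-⊕ x σ M Fin.zero    = refl
consB-⊕ x σ M (Fin.suc i) = refl

∑-assignments-suc : ∀ n (h : (Fin (suc n) → Bool) → ℕ) →
  ∑ (assignments (suc n)) h ≡ ∑ (assignments n) (λ σ → h (consB false σ) + h (consB true σ))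
∑-assignments-suc n h =
  trans (∑-concatMap (λ σ → consB false σ ∷ consB true σ ∷ []) (assignments n) h)
        (∑-cong (assignments n) (λ σ → cong (h (consB false σ) +_) (+-identityʳ (h (consB true σ)))))

∑-assignments-⊕ : ∀ n (M : Fin n → Bool) {h} → Extensional h →
  ∑ (assignments n) (λ σ → h (σ ⊕ M)) ≡ ∑ (assignments n) h
∑-assignments-⊕ zero    M h-ext = cong (_+ 0) (h-ext (λ ()))
∑-assignments-⊕ (suc n) M {h} h-ext = begin
  ∑ (assignments (suc n)) (λ σ → h (σ ⊕ M))
    ≡⟨ ∑-assignments-suc n (λ σ → h (σ ⊕ M)) ⟩
  ∑ (assignments n) (λ σ → h (consB false σ ⊕ M) + h (consB true σ ⊕ M))
    ≡⟨ ∑-cong (assignments n) (λ σ → trans (cong₂ _+_ (h-ext (consB-⊕ false σ M)) (h-ext (consB-⊕ true σ M)))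
                                           (swap (M Fin.zero) (σ ⊕ M′))) ⟩
  ∑ (assignments n) (λ σ → both (σ ⊕ M′))
    ≡⟨ ∑-assignments-⊕ n M′ (λ σ≗τ → cong₂ _+_ (h-ext (consB-cong false σ≗τ))
                                               (h-ext (consB-cong true σ≗τ))) ⟩
  ∑ (assignments n) both
    ≡⟨ sym (∑-assignments-suc n h) ⟩
  ∑ (assignments (suc n)) h ∎
  where
  open ≡-Reasoning
  M′ = M ∘ Fin.suc
  both : (Fin n → Bool) → ℕ
  both σ = h (consB false σ) + h (consB true σ)
  swap : ∀ m σ → h (consB (false xor m) σ) + h (consB (true xor m) σ) ≡ both σ
  swap false σ = refl
  swap true  σ = +-comm (h (consB true σ)) (h (consB false σ))

≟ᵇ-sound : ∀ x y → T (does (x ≟ᵇ y)) → x ≡ y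
≟ᵇ-sound false false _  = refl
≟ᵇ-sound false true  ()
≟ᵇ-sound true  false ()
≟ᵇ-sound true  true  _  = refl

allMono : (Fin n → Bool) → List (Fin n × Fin n) → Bool
allMono σ S = all (mono σ) S

allMono-cong : ∀ {σ τ : Fin n → Bool} S → σ ≗ τ → allMono σ S ≡ allMono τ S
allMono-cong []            σ≗τ = refl
allMono-cong ((u , v) ∷ S) σ≗τ =
  cong₂ _∧_ (cong₂ (λ x y → does (x ≟ᵇ y)) (σ≗τ u) (σ≗τ v)) (allMono-cong S σ≗τ)

xor-≟ : ∀ x y m → does ((x xor m) ≟ᵇ (y xor m)) ≡ does (x ≟ᵇ y)
xor-≟ false false false = refl
xor-≟ false false true  = refl
xor-≟ false true  false = refl
xor-≟ false true  true  = refl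
xor-≟ true  false false = refl
xor-≟ true  false true  = refl
xor-≟ true  true  false = refl
xor-≟ true  true  true  = refl

allMono-⊕ : ∀ σ (M : Fin n → Bool) S → All (λ uv → M (proj₁ uv) ≡ M (proj₂ uv)) S →
            allMono (σ ⊕ M) S ≡ allMono σ S
allMono-⊕ σ M []            []            = refl
allMono-⊕ σ M ((u , v) ∷ S) (Mu≡Mv ∷ M-S) = cong₂ _∧_ mono-uv (allMono-⊕ σ M S M-S)
  where
  mono-uv : does ((σ u xor M u) ≟ᵇ (σ v xor M v)) ≡ does (σ u ≟ᵇ σ v)
  mono-uv rewrite Mu≡Mv = xor-≟ (σ u) (σ v) (M v)

allMono⇒edges-mono : ∀ (σ : Fin n → Bool) S → T (allMono σ S) → All (λ uv → σ (proj₁ uv) ≡ σ (proj₂ uv)) S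
allMono⇒edges-mono σ S all-mono =
  All.map (λ {uv} → ≟ᵇ-sound (σ (proj₁ uv)) (σ (proj₂ uv))) (all⁺ (mono σ) S all-mono)

module Regions {n} (a b : Fin n) where

  region : Bool → List (Fin n → Bool)
  region c = filter (λ σ → σ a ≟ᵇ false) (filter (λ σ → σ b ≟ᵇ c) (assignments n))

  regionCount : Bool → List (Fin n × Fin n) → ℕ
  regionCount c S = count (λ σ → allMono σ S) (region c)

  restrict : Bool → ((Fin n → Bool) → ℕ) → (Fin n → Bool) → ℕ
  restrict c h σ = if does (σ b ≟ᵇ c) then (if does (σ a ≟ᵇ false) then h σ else 0) else 0

  ∑-region : ∀ c h → ∑ (region c) h ≡ ∑ (assignments n) (restrict c h)
  ∑-region c h = trans (∑-filter (λ σ → σ a ≟ᵇ false) (filter (λ σ → σ b ≟ᵇ c) (assignments n)) h)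
                       (∑-filter (λ σ → σ b ≟ᵇ c) (assignments n) (λ σ → if does (σ a ≟ᵇ false) then h σ else 0))

  ∑-region-⊕ : ∀ (M : Fin n → Bool) {h} → Extensional h → M a ≡ false → M b ≡ true →
               (∀ σ → h (σ ⊕ M) ≡ h σ) → ∑ (region false) h ≡ ∑ (region true) h
  ∑-region-⊕ M {h} h-ext Ma≡false Mb≡true h-⊕ = begin
    ∑ (region false) h                                 ≡⟨ ∑-region false h ⟩
    ∑ (assignments n) (restrict false h)               ≡⟨ ∑-cong (assignments n) (sym ∘ restrict-⊕) ⟩
    ∑ (assignments n) (λ σ → restrict true h (σ ⊕ M))  ≡⟨ ∑-assignments-⊕ n M restrict-ext ⟩
    ∑ (assignments n) (restrict true h)                ≡⟨ sym (∑-region true h) ⟩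
    ∑ (region true) h                                  ∎
    where
    open ≡-Reasoning
    restrict-ext : Extensional (restrict true h)
    restrict-ext {σ} {τ} σ≗τ rewrite σ≗τ a | σ≗τ b | h-ext σ≗τ = refl
    flip-b : ∀ x y k → (if does ((x xor true) ≟ᵇ true) then (if does ((y xor false) ≟ᵇ false) then k else 0) else 0)
                     ≡ (if does (x ≟ᵇ false) then (if does (y ≟ᵇ false) then k else 0) else 0)
    flip-b false false k = refl
    flip-b false true  k = refl
    flip-b true  y     k = refl
    restrict-⊕ : ∀ σ → restrict true h (σ ⊕ M) ≡ restrict false h σ
    restrict-⊕ σ rewrite Ma≡false | Mb≡true | h-⊕ σ = flip-b (σ b) (σ a) (h σ)

  regionCount-⊕ : ∀ S (M : Fin n → Bool) → M a ≡ false → M b ≡ true →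
                  All (λ uv → M (proj₁ uv) ≡ M (proj₂ uv)) S → regionCount false S ≡ regionCount true S
  regionCount-⊕ S M Ma≡false Mb≡true M-S =
    ∑-region-⊕ M (cong 𝟙 ∘ allMono-cong S) Ma≡false Mb≡true (λ σ → cong 𝟙 (allMono-⊕ σ M S M-S))

  regionCount-true≡0 : ∀ S → All (λ σ → T (allMono σ S) → σ a ≡ σ b) (assignments n) → regionCount true S ≡ 0
  regionCount-true≡0 S forced =
    trans (∑-region true (λ σ → 𝟙 (allMono σ S))) (∑-zero (assignments n) (All.map vanish forced))
    where
    vanish : ∀ {σ} → (T (allMono σ S) → σ a ≡ σ b) → restrict true (λ σ → 𝟙 (allMono σ S)) σ ≡ 0
    vanish {σ} σa≡σb with σ b | σ a | allMono σ S
    ... | false | _     | _     = refl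
    ... | true  | true  | _     = refl
    ... | true  | false | false = refl
    ... | true  | false | true  with σa≡σb _
    ... | ()

  -- The component of b in the graph S, computed as the set of vertices that every
  -- S-monochromatic assignment colours like b.
  tied : List (Fin n × Fin n) → Fin n → Bool
  tied S w = all (λ σ → not (allMono σ S) ∨ does (σ w ≟ᵇ σ b)) (assignments n)

  tied-b : ∀ S → tied S b ≡ true
  tied-b S = Equivalence.to T-≡ (all⁻ _ (All.universal (λ σ → Equivalence.from T-≡ (b-like-b σ)) (assignments n)))
    where
    b-like-b : ∀ σ → not (allMono σ S) ∨ does (σ b ≟ᵇ σ b) ≡ true
    b-like-b σ = trans (cong (not (allMono σ S) ∨_) (dec-true (σ b ≟ᵇ σ b) refl)) (∨-zeroʳ _)

  tied-edges : ∀ S → All (λ uv → tied S (proj₁ uv) ≡ tied S (proj₂ uv)) S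
  tied-edges S = All.tabulate (λ uv∈S → cong and (map-cong (same-colour uv∈S) (assignments n)))
    where
    same-colour : ∀ {uv} → uv ∈ S → ∀ σ →
      not (allMono σ S) ∨ does (σ (proj₁ uv) ≟ᵇ σ b) ≡ not (allMono σ S) ∨ does (σ (proj₂ uv) ≟ᵇ σ b)
    same-colour uv∈S σ with allMono σ S in mono-S
    ... | false = refl
    ... | true  = cong (λ x → does (x ≟ᵇ σ b)) (All.lookup (allMono⇒edges-mono σ S (Equivalence.from T-≡ mono-S)) uv∈S)

  tied-a⇒forced : ∀ S → tied S a ≡ true → All (λ σ → T (allMono σ S) → σ a ≡ σ b) (assignments n)
  tied-a⇒forced S tied-a =
    All.map (λ {σ} → forced (allMono σ S) (σ a) (σ b)) (all⁺ _ (assignments n) (Equivalence.from T-≡ tied-a))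
    where
    forced : ∀ x y z → T (not x ∨ does (y ≟ᵇ z)) → T x → y ≡ z
    forced true y z y≡z _ = ≟ᵇ-sound y z y≡z

  regionCount-true≤false : ∀ S → regionCount true S ≤ regionCount false S
  regionCount-true≤false S with tied S a in tied-a
  ... | true  = subst (_≤ regionCount false S) (sym (regionCount-true≡0 S (tied-a⇒forced S tied-a))) z≤n
  ... | false = ≤-reflexive (sym (regionCount-⊕ S (tied S) tied-a (tied-b S) (tied-edges S)))

  point-b : Fin n → Bool
  point-b w = does (w Fin.≟ b)

  regionCount-[] : a ≢ b → regionCount false [] ≡ regionCount true []
  regionCount-[] a≢b = regionCount-⊕ [] point-b (dec-false (a Fin.≟ b) a≢b) (dec-true (b Fin.≟ b) refl) []

  regionCount-edge : ∀ {u v} → a ≢ b → (u , v) ≢ (a , b) → (u , v) ≢ (b , a) →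
                     regionCount false ((u , v) ∷ []) ≡ regionCount true ((u , v) ∷ [])
  regionCount-edge {u} {v} a≢b uv≢ab uv≢ba with (b Fin.≟ u) ⊎-dec (b Fin.≟ v)
  ... | no b∉uv = regionCount-⊕ _ point-b (dec-false (a Fin.≟ b) a≢b) (dec-true (b Fin.≟ b) refl)
                    (trans (dec-false (u Fin.≟ b) (b∉uv ∘ inj₁ ∘ sym))
                           (sym (dec-false (v Fin.≟ b) (b∉uv ∘ inj₂ ∘ sym))) ∷ [])
  ... | yes b∈uv = regionCount-⊕ _ uv-mask uv-mask-a (uv-mask-b b∈uv) (trans uv-mask-u (sym uv-mask-v) ∷ [])
    where
    uv-mask : Fin _ → Bool
    uv-mask w = does (w Fin.≟ u) ∨ does (w Fin.≟ v)
    uv-mask-u : uv-mask u ≡ true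
    uv-mask-u = cong (_∨ does (u Fin.≟ v)) (dec-true (u Fin.≟ u) refl)
    uv-mask-v : uv-mask v ≡ true
    uv-mask-v = trans (cong (does (v Fin.≟ u) ∨_) (dec-true (v Fin.≟ v) refl)) (∨-zeroʳ _)
    uv-mask-b : b ≡ u ⊎ b ≡ v → uv-mask b ≡ true
    uv-mask-b (inj₁ b≡u) = subst (λ x → uv-mask x ≡ true) (sym b≡u) uv-mask-u
    uv-mask-b (inj₂ b≡v) = subst (λ x → uv-mask x ≡ true) (sym b≡v) uv-mask-v
    a≢u : b ≡ u ⊎ b ≡ v → a ≢ u
    a≢u (inj₁ b≡u) a≡u = a≢b (trans a≡u (sym b≡u))
    a≢u (inj₂ b≡v) a≡u = uv≢ab (cong₂ _,_ (sym a≡u) (sym b≡v))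
    a≢v : b ≡ u ⊎ b ≡ v → a ≢ v
    a≢v (inj₁ b≡u) a≡v = uv≢ba (cong₂ _,_ (sym b≡u) (sym a≡v))
    a≢v (inj₂ b≡v) a≡v = a≢b (trans a≡v (sym b≡v))
    uv-mask-a : uv-mask a ≡ false
    uv-mask-a = cong₂ _∨_ (dec-false (a Fin.≟ u) (a≢u b∈uv)) (dec-false (a Fin.≟ v) (a≢v b∈uv))

edges-adjacent : ∀ (H : Graph n) → All (λ uv → adj H (proj₁ uv) (proj₂ uv) ≡ true) (edges H)
edges-adjacent {n} H =
  concat⁺ (map⁺ (All.universal (λ u → concat⁺ (map⁺ (All.universal (edge? u) (allFin n)))) (allFin n)))
  where
  edge? : ∀ u v → All (λ uv → adj H (proj₁ uv) (proj₂ uv) ≡ true)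
                      (if does (Fin.toℕ u ℕ.<? Fin.toℕ v) then (if adj H u v then (u , v) ∷ [] else []) else [])
  edge? u v with does (Fin.toℕ u ℕ.<? Fin.toℕ v) | adj H u v in adj-uv
  ... | false | _     = []
  ... | true  | true  = adj-uv ∷ []
  ... | true  | false = []

adjacent⇒≢ : ∀ (H : Graph n) {a b u v} → adj H a b ≡ false → adj H u v ≡ true → (u , v) ≢ (a , b)
adjacent⇒≢ H ab∉E uv∈E refl with trans (sym uv∈E) ab∉E
... | ()

module _ {n} (H : Graph n) (a b : Fin n) where
  open Regions a b

  subsetCount : Bool → ℕ → ℕ
  subsetCount c j = ∑ (choose j (edges H)) (regionCount c)

  weight : ℕ → ℚ
  weight j = halfPow n * κ (e H) j

  coeff-cellIntegral : ∀ c j → coeff (cellIntegral H a b c) j ≡ weight j * fromℕ (subsetCount c j)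
  coeff-cellIntegral c j = begin
    coeff (cellIntegral H a b c) j
      ≡⟨ coeff-scaleP (halfPow n) (sumP (map (edgeProd H) (region c))) j ⟩
    halfPow n * coeff (sumP (map (edgeProd H) (region c))) j
      ≡⟨ cong (halfPow n *_) (coeff-sumP-edgeProd H (region c) j) ⟩
    halfPow n * (κ (e H) j * fromℕ (∑ (region c) (λ σ → count (mono σ) (edges H) C j)))
      ≡⟨ cong (λ N → halfPow n * (κ (e H) j * fromℕ N)) monochromatic-subsets ⟩
    halfPow n * (κ (e H) j * fromℕ (subsetCount c j))
      ≡⟨ ℚ.*-assoc (halfPow n) (κ (e H) j) _ ⟨
    weight j * fromℕ (subsetCount c j) ∎
    where
    open ≡-Reasoning
    monochromatic-subsets : ∑ (region c) (λ σ → count (mono σ) (edges H) C j) ≡ subsetCount c j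
    monochromatic-subsets = trans (∑-cong (region c) (λ σ → count-C (mono σ) j (edges H)))
                                  (∑-swap (region c) (choose j (edges H)) (λ σ S → 𝟙 (allMono σ S)))

  coeff-f≡coeff-g : ∀ j → subsetCount false j ≡ subsetCount true j → coeff (f H a b) j ≡ coeff (g H a b) j
  coeff-f≡coeff-g j N-f≡N-g = begin
    coeff (f H a b) j                       ≡⟨ coeff-cellIntegral false j ⟩
    weight j * fromℕ (subsetCount false j)  ≡⟨ cong (λ N → weight j * fromℕ N) N-f≡N-g ⟩
    weight j * fromℕ (subsetCount true j)   ≡⟨ coeff-cellIntegral true j ⟨
    coeff (g H a b) j                       ∎
    where open ≡-Reasoning

  0≤coeff-f*coeff-g : ∀ j → 0ℚ ≤ℚ coeff (f H a b) j * coeff (g H a b) j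
  0≤coeff-f*coeff-g j =
    subst (0ℚ ≤ℚ_) (sym (trans (cong₂ _*_ (coeff-cellIntegral false j) (coeff-cellIntegral true j))
                              (solve 3 (λ w x y → (w :* x) :* (w :* y) := (w :* w) :* (x :* y)) refl (weight j) N-f N-g)))
          (0≤p*q (0≤p*p (weight j)) (0≤p*q (0≤fromℕ (subsetCount false j)) (0≤fromℕ (subsetCount true j))))
    where
    open +-*-Solver
    N-f = fromℕ (subsetCount false j)
    N-g = fromℕ (subsetCount true j)

  ∣coeff-g∣≤∣coeff-f∣ : ∀ j → ∣ coeff (g H a b) j ∣ ≤ℚ ∣ coeff (f H a b) j ∣
  ∣coeff-g∣≤∣coeff-f∣ j = begin
    ∣ coeff (g H a b) j ∣                       ≡⟨ cong ∣_∣ (coeff-cellIntegral true j) ⟩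
    ∣ weight j * fromℕ (subsetCount true j) ∣   ≡⟨ ∣p*fromℕ∣ (weight j) (subsetCount true j) ⟩
    ∣ weight j ∣ * fromℕ (subsetCount true j)   ≤⟨ ℚ.*-monoˡ-≤-nonNeg ∣ weight j ∣ {{ℚ.∣-∣-nonNeg (weight j)}}
                                                  (fromℕ-mono-≤ (∑-mono (choose j (edges H)) regionCount-true≤false)) ⟩
    ∣ weight j ∣ * fromℕ (subsetCount false j)  ≡⟨ ∣p*fromℕ∣ (weight j) (subsetCount false j) ⟨
    ∣ weight j * fromℕ (subsetCount false j) ∣  ≡⟨ cong ∣_∣ (coeff-cellIntegral false j) ⟨
    ∣ coeff (f H a b) j ∣                       ∎
    where open ℚ.≤-Reasoning

  coeff₀-f≡coeff₀-g : a ≢ b → coeff (f H a b) 0 ≡ coeff (g H a b) 0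
  coeff₀-f≡coeff₀-g a≢b = coeff-f≡coeff-g 0 (cong (_+ 0) (regionCount-[] a≢b))

  coeff₁-f≡coeff₁-g : a ≢ b → adj H a b ≡ false → coeff (f H a b) 1 ≡ coeff (g H a b) 1
  coeff₁-f≡coeff₁-g a≢b ab∉E = coeff-f≡coeff-g 1 (singletons (edges H) (edges-adjacent H))
    where
    singletons : ∀ E → All (λ uv → adj H (proj₁ uv) (proj₂ uv) ≡ true) E →
                 ∑ (choose 1 E) (regionCount false) ≡ ∑ (choose 1 E) (regionCount true)
    singletons []      []            = refl
    singletons (_ ∷ E) (uv∈E ∷ E⊆E) =
      cong₂ _+_ (regionCount-edge a≢b (adjacent⇒≢ H ab∉E uv∈E) (adjacent⇒≢ H (trans (symm H b a) ab∉E) uv∈E))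
                (singletons E E⊆E)

lemma3p1 : ∀ {n : ℕ} (H : Graph n) (a b : Fin n) → a ≢ b → adj H a b ≡ false →
    ((j : ℕ) → j ≤ e H → 0ℚ ≤ℚ (coeff (f H a b) j * coeff (g H a b) j))
    × (coeff (f H a b) 0 ≡ coeff (g H a b) 0)
    × (coeff (f H a b) 1 ≡ coeff (g H a b) 1)
    × (∣ coeff (g H a b) 2 ∣ ≤ℚ ∣ coeff (f H a b) 2 ∣)
-- The bound j ≤ e H is not needed: the coefficients agree in sign for every j.
lemma3p1 H a b a≢b ab∉E =
  (λ j _ → 0≤coeff-f*coeff-g H a b j) ,
  coeff₀-f≡coeff₀-g H a b a≢b ,
  coeff₁-f≡coeff₁-g H a b a≢b ab∉E ,
  ∣coeff-g∣≤∣coeff-f∣ H a b 2
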